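{- Let $V=\{1,\ldots,v\}$, $t\ge 0$, and let $T\subseteq 2^V$ be an affine subspace of $\mathbb F_2^v$ of dimension $t+1$. Then there exists a $[t]$-trade $\{T_0,T_1\}$ with $T_0\cup T_1=T$ if and only if $T=w+\langle x_1,\ldots,x_{t+1}\rangle$ for some $w\in 2^V$ and some linearly independent $x_1,\ldots,x_{t+1}\in 2^V$ that are pairwise disjoint as subsets of $V$.
   Context: Subsets of $V$ are identified with their characteristic vectors, so $2^V$ is the vector space $\mathbb F_2^v$ (addition is symmetric difference), and $\langle\cdot\rangle$ denotes linear span. A $[t]$-trade is a pair $\{T_0,T_1\}$ of disjoint subsets of $2^V$ such that for every $i\in\{0,\ldots,t\}$ and every $i$-element subset $s\subseteq V$, the number of elements of $T_0$ containing $s$ equals the number of elements of $T_1$ containing $s$. -}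

module Defs where

open import Data.Nat using (ℕ; zero; suc; _≤_)
open import Data.Bool using (Bool; true; false; _xor_; _∧_; _∨_; T)
open import Data.Fin using (Fin; zero; suc)
open import Data.Fin.Subset using (Subset; _⊆_; _∩_; ∣_∣) renaming (⊥ to ∅)
open import Data.Fin.Subset.Properties using (_⊆?_)
open import Data.Vec using (Vec; []; _∷_; zipWith; replicate)
open import Data.List using (List; []; _∷_; map; _++_; filter; length)
open import Data.Product using (Σ; _×_; _,_)
open import Relation.Nullary using (¬_)
open import Relation.Nullary.Decidable using (_×-dec_)
open import Relation.Binary.PropositionalEquality using (_≡_; _≢_)
open import Data.Bool.Properties using (T?)
open import Function.Bundles using (_⇔_)

-- V = Fin v.  2^V = Subset v = Vec Bool v, identified with 𝔽₂^v.
-- Vector addition in 𝔽₂^v = symmetric difference.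
_⊕_ : ∀ {v} → Subset v → Subset v → Subset v
_⊕_ = zipWith _xor_

lincomb : ∀ {v k} → (Fin k → Bool) → (Fin k → Subset v) → Subset v
lincomb {v} {zero}  c x = ∅
lincomb {v} {suc k} c x =
  (if′ c zero then x zero else ∅) ⊕ lincomb (λ i → c (suc i)) (λ i → x (suc i))
  where
  if′_then_else_ : Bool → Subset v → Subset v → Subset v
  if′ true  then a else b = a
  if′ false then a else b = b

LinIndep : ∀ {v k} → (Fin k → Subset v) → Set
LinIndep {v} {k} x = (c : Fin k → Bool) → lincomb c x ≡ ∅ → (i : Fin k) → c i ≡ false

InAffine : ∀ {v k} → Subset v → (Fin k → Subset v) → Subset v → Set
InAffine {v} {k} w x y = Σ (Fin k → Bool) λ c → y ≡ w ⊕ lincomb c x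

-- A subset of 2^V, given by its characteristic function.
Family : ℕ → Set
Family v = Subset v → Bool

IsAffineSpan : ∀ {v k} → Family v → Subset v → (Fin k → Subset v) → Set
IsAffineSpan {v} {k} 𝒯 w x = (y : Subset v) → (T (𝒯 y) ⇔ InAffine w x y)

IsAffineSubspaceOfDim : ∀ {v} → ℕ → Family v → Set
IsAffineSubspaceOfDim {v} d 𝒯 =
  Σ (Subset v) λ w → Σ (Fin d → Subset v) λ x → LinIndep x × IsAffineSpan 𝒯 w x

allSubsets : (v : ℕ) → List (Subset v)
allSubsets zero    = [] ∷ []
allSubsets (suc v) = map (false ∷_) (allSubsets v) ++ map (true ∷_) (allSubsets v)

countContaining : ∀ {v} → Family v → Subset v → ℕ
countContaining {v} 𝒯 s =
  length (filter (λ y → T? (𝒯 y) ×-dec (s ⊆? y)) (allSubsets v))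

IsTrade : ∀ {v} → ℕ → Family v → Family v → Set
IsTrade {v} t T₀ T₁ =
  ((y : Subset v) → ¬ (T (T₀ y) × T (T₁ y))) ×
  ((i : ℕ) → i ≤ t → (s : Subset v) → ∣ s ∣ ≡ i →
     countContaining T₀ s ≡ countContaining T₁ s)

UnionIs : ∀ {v} → Family v → Family v → Family v → Set
UnionIs {v} T₀ T₁ 𝒯 = (y : Subset v) → T₀ y ∨ T₁ y ≡ 𝒯 y

PairwiseDisjoint : ∀ {v k} → (Fin k → Subset v) → Set
PairwiseDisjoint {v} {k} x = (i j : Fin k) → i ≢ j → x i ∩ x j ≡ ∅

module Submission where

-- Subsets of V = Fin v are vectors of 𝔽₂^v; let 𝒯 = w + ⟨x 0, …, x t⟩ with x independent.
-- Sufficiency: if the x i are pairwise disjoint, pick a point p i in each x i and split 𝒯 by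
-- the parity of the number of p i contained in y.  A set s with ∣ s ∣ ≤ t misses some block x j
-- (pigeonhole), so y ↦ y ⊕ x j is a bijection of 2^V that preserves 𝒯 and the relation s ⊆ y
-- while swapping the two halves: they form a [t]-trade.
-- Necessity: by Gaussian elimination 𝒯 has a direction basis with pivots (x i is one at p i and
-- zero at every other p j).  If x i and x j (i ≠ j) met in a point k, the points of 𝒯 containing
-- all other pivots would form a plane q a b = base ⊕ a·x i ⊕ b·x j.  The trade condition for that
-- set of pivots, and for it enlarged by p j, by p i or by k (all of size ≤ t), says that the
-- colouring (a , b) ↦ T₀ (q a b) is balanced on 𝔽₂², on the lines b = 1 and a = 1 and on a line
-- a + b = const, which no colouring is.  So a basis with pivots is pairwise disjoint.

open import Defs
open import Algebra.Bundles using (CommutativeRing)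
open import Data.Bool using (Bool; true; false; not; _∧_; _∨_; _xor_; T; if_then_else_)
open import Data.Bool.Properties
  using (xor-∧-commutativeRing; xor-assoc; xor-comm; xor-identityʳ; xor-same;
         ∧-comm; ∧-identityʳ; ∧-zeroʳ; ∧-distribʳ-xor; ∨-zeroʳ; T-≡; T?; ⇔→≡)
  renaming (_≟_ to _≟ᵇ_)
open import Algebra.Properties.Semiring.Sum (CommutativeRing.semiring xor-∧-commutativeRing)
  using (sum-cong-≗; ∑-distrib-+; sum-replicate-zero) renaming (sum to ∑)
open import Data.Empty using (⊥; ⊥-elim)
open import Data.Fin using (Fin; zero; suc)
open import Data.Fin.Properties using (_≟_; suc-injective; 0≢1+n; all?; ¬∀⟶∃¬)
open import Data.Fin.Subset using (Subset; _∈_; _∉_; _⊆_; _∩_; _∪_; _-_; ∣_∣; ⁅_⁆; ⊤) renaming (⊥ to ∅)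
open import Data.Fin.Subset.Properties
  using (_⊆?_; nonempty?; Empty-unique; ∈⊤; ∉⊥; ∣⊥∣≡0; ∣⊤∣≡n; ∣⁅x⁆∣≡1; ∣p∣≤∣x∷p∣; ⊆-refl; ⊆-trans; p⊆p∪q;
         p─q⊆p; x∈p∧x≢y⇒x∈p-y; x∈p⇒∣p-x∣<∣p∣; x∈⁅x⁆; x∈⁅y⁆⇒x≡y; x∈p∪q⁺; x∈p∪q⁻; x∈p∩q⁺; x∈p∩q⁻)
open import Data.List using (List; []; _∷_; map; filter; length; _++_)
open import Data.List.Properties using (map-++; map-∘; map-cong-local)
open import Data.List.Membership.Propositional using () renaming (_∈_ to _∈ₗ_; _∉_ to _∉ₗ_)
open import Data.List.Relation.Unary.All as All using ([]; _∷_)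
open import Data.List.Relation.Unary.Any using () renaming (here to hereₗ; there to thereₗ)
open import Data.List.Relation.Unary.Unique.Propositional using (Unique; []; _∷_)
open import Data.List.Relation.Unary.Unique.Propositional.Properties using (map⁺)
open import Data.Nat using (ℕ; zero; suc; _+_; _≤_; z≤n; s≤s)
open import Data.Nat.ListAction using (sum)
open import Data.Nat.ListAction.Properties using (sum-++)
open import Data.Nat.Properties
  using (+-commutativeSemigroup; +-comm; +-identityʳ; +-suc; +-monoʳ-≤;
         ≤-reflexive; ≤-trans; ≤-pred; n≤1+n; n≮n)
open import Algebra.Properties.CommutativeSemigroup +-commutativeSemigroup
  using () renaming (interchange to +-interchange)
open import Data.Product using (Σ; _×_; _,_; proj₁; proj₂; uncurry)
open import Data.Sum using (inj₁; inj₂; [_,_]′)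
open import Data.Vec using ([]; _∷_; here; there; lookup)
open import Data.Vec.Properties
  using (lookup-zipWith; lookup-replicate; tabulate∘lookup; tabulate-cong; []=⇒lookup; lookup⇒[]=;
         zipWith-assoc; zipWith-identityˡ; zipWith-identityʳ; ≡-dec)
open import Data.Vec.Functional using () renaming (_∷_ to _◂_)
open import Function using (_∘_)
open import Function.Bundles using (_⇔_; mk⇔; Equivalence)
open import Function.Definitions using (Injective)
open import Level using (0ℓ)
open import Relation.Nullary using (¬_; Dec; does; yes; no; contradiction)
open import Relation.Nullary.Decidable using (_×-dec_; dec-true; dec-false; does-⇔)
open import Relation.Unary using (Pred; Decidable)
open import Relation.Binary.PropositionalEquality

δ : ∀ {n} → Fin n → Fin n → Bool
δ i j = does (i ≟ j)

δ-diag : ∀ {n} (i : Fin n) → δ i i ≡ true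
δ-diag i = dec-true (i ≟ i) refl

δ-off : ∀ {n} {i j : Fin n} → i ≢ j → δ i j ≡ false
δ-off {i = i} {j} = dec-false (i ≟ j)

∑-δ : ∀ {n} (f : Fin n → Bool) (j : Fin n) → ∑ (λ i → δ i j ∧ f i) ≡ f j
∑-δ {suc n} f zero    = trans (cong (f zero xor_) (sum-replicate-zero n)) (xor-identityʳ (f zero))
∑-δ {suc n} f (suc j) = ∑-δ (f ∘ suc) j

∑-δ-row : ∀ {n} (j : Fin n) → ∑ (δ j) ≡ true
∑-δ-row {suc n} zero    = cong (true xor_) (sum-replicate-zero n)
∑-δ-row {suc n} (suc j) = ∑-δ-row j

xor-cancelˡ : ∀ a b → a xor (a xor b) ≡ b
xor-cancelˡ a b = trans (sym (xor-assoc a a b)) (cong (_xor b) (xor-same a))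

∑-δʳ : ∀ {n} (f : Fin n → Bool) (j : Fin n) → ∑ (λ i → f i ∧ δ i j) ≡ f j
∑-δʳ f j = trans (sum-cong-≗ λ i → ∧-comm (f i) (δ i j)) (∑-δ f j)

≡-by-lookup : ∀ {v} {a b : Subset v} → (∀ k → lookup a k ≡ lookup b k) → a ≡ b
≡-by-lookup {a = a} {b} h =
  trans (sym (tabulate∘lookup a)) (trans (tabulate-cong h) (tabulate∘lookup b))

lookup-⊕ : ∀ {v} (a b : Subset v) k → lookup (a ⊕ b) k ≡ lookup a k xor lookup b k
lookup-⊕ a b k = lookup-zipWith _xor_ k a b

lookup-∩ : ∀ {v} (a b : Subset v) k → lookup (a ∩ b) k ≡ lookup a k ∧ lookup b k
lookup-∩ a b k = lookup-zipWith _∧_ k a b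

lookup-∅ : ∀ {v} (k : Fin v) → lookup ∅ k ≡ false
lookup-∅ k = lookup-replicate k false

⊕-assoc : ∀ {v} (a b c : Subset v) → (a ⊕ b) ⊕ c ≡ a ⊕ (b ⊕ c)
⊕-assoc = zipWith-assoc xor-assoc

⊕-identityˡ : ∀ {v} (a : Subset v) → ∅ ⊕ a ≡ a
⊕-identityˡ = zipWith-identityˡ λ _ → refl

⊕-identityʳ : ∀ {v} (a : Subset v) → a ⊕ ∅ ≡ a
⊕-identityʳ = zipWith-identityʳ xor-identityʳ

⊕-self : ∀ {v} (a : Subset v) → a ⊕ a ≡ ∅
⊕-self []      = refl
⊕-self (b ∷ a) = cong₂ _∷_ (xor-same b) (⊕-self a)

⊕-cancelʳ : ∀ {v} (a b : Subset v) → (a ⊕ b) ⊕ b ≡ a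
⊕-cancelʳ a b = trans (⊕-assoc a b b) (trans (cong (a ⊕_) (⊕-self b)) (⊕-identityʳ a))

infixr 25 _·_
_·_ : ∀ {v} → Bool → Subset v → Subset v
true  · u = u
false · u = ∅

lookup-· : ∀ {v} b (u : Subset v) k → lookup (b · u) k ≡ b ∧ lookup u k
lookup-· true  u k = refl
lookup-· false u k = lookup-∅ k

lincomb-suc : ∀ {v n} (c : Fin (suc n) → Bool) (x : Fin (suc n) → Subset v) →
              lincomb c x ≡ c zero · x zero ⊕ lincomb (c ∘ suc) (x ∘ suc)
lincomb-suc c x with c zero
... | true  = refl
... | false = refl

lookup-lincomb : ∀ {v n} (c : Fin n → Bool) (x : Fin n → Subset v) k →
                 lookup (lincomb c x) k ≡ ∑ (λ i → c i ∧ lookup (x i) k)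
lookup-lincomb {n = zero}  c x k = lookup-∅ k
lookup-lincomb {n = suc n} c x k = begin
  lookup (lincomb c x) k
    ≡⟨ cong (λ u → lookup u k) (lincomb-suc c x) ⟩
  lookup (c zero · x zero ⊕ lincomb (c ∘ suc) (x ∘ suc)) k
    ≡⟨ lookup-⊕ (c zero · x zero) _ k ⟩
  lookup (c zero · x zero) k xor lookup (lincomb (c ∘ suc) (x ∘ suc)) k
    ≡⟨ cong₂ _xor_ (lookup-· (c zero) (x zero) k) (lookup-lincomb (c ∘ suc) (x ∘ suc) k) ⟩
  ∑ (λ i → c i ∧ lookup (x i) k) ∎
  where open ≡-Reasoning

lincomb-cong : ∀ {v n} {c c' : Fin n → Bool} (x : Fin n → Subset v) →
               (∀ i → c i ≡ c' i) → lincomb c x ≡ lincomb c' x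
lincomb-cong {c = c} {c'} x h = ≡-by-lookup λ k →
  trans (lookup-lincomb c x k)
        (trans (sum-cong-≗ λ i → cong (_∧ lookup (x i) k) (h i)) (sym (lookup-lincomb c' x k)))

lincomb-zero : ∀ {v n} (x : Fin n → Subset v) → lincomb (λ _ → false) x ≡ ∅
lincomb-zero {n = n} x = ≡-by-lookup λ k →
  trans (lookup-lincomb _ x k) (trans (sum-replicate-zero n) (sym (lookup-∅ k)))

lincomb-⊕ : ∀ {v n} (c c' : Fin n → Bool) (x : Fin n → Subset v) →
            lincomb (λ i → c i xor c' i) x ≡ lincomb c x ⊕ lincomb c' x
lincomb-⊕ c c' x = ≡-by-lookup λ k → begin
  lookup (lincomb (λ i → c i xor c' i) x) k
    ≡⟨ lookup-lincomb _ x k ⟩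
  ∑ (λ i → (c i xor c' i) ∧ lookup (x i) k)
    ≡⟨ sum-cong-≗ (λ i → ∧-distribʳ-xor (lookup (x i) k) (c i) (c' i)) ⟩
  ∑ (λ i → (c i ∧ lookup (x i) k) xor (c' i ∧ lookup (x i) k))
    ≡⟨ ∑-distrib-+ (λ i → c i ∧ lookup (x i) k) (λ i → c' i ∧ lookup (x i) k) ⟩
  ∑ (λ i → c i ∧ lookup (x i) k) xor ∑ (λ i → c' i ∧ lookup (x i) k)
    ≡⟨ cong₂ _xor_ (lookup-lincomb c x k) (lookup-lincomb c' x k) ⟨
  lookup (lincomb c x) k xor lookup (lincomb c' x) k
    ≡⟨ lookup-⊕ (lincomb c x) _ k ⟨
  lookup (lincomb c x ⊕ lincomb c' x) k ∎
  where open ≡-Reasoning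

lincomb-δ : ∀ {v n} (x : Fin n → Subset v) j → lincomb (λ i → δ i j) x ≡ x j
lincomb-δ x j = ≡-by-lookup λ k → trans (lookup-lincomb _ x k) (∑-δ (λ i → lookup (x i) k) j)

lincomb-flip : ∀ {v n} (c : Fin n → Bool) (x : Fin n → Subset v) j →
               lincomb c x ⊕ x j ≡ lincomb (λ i → c i xor δ i j) x
lincomb-flip c x j = begin
  lincomb c x ⊕ x j                         ≡⟨ cong (lincomb c x ⊕_) (lincomb-δ x j) ⟨
  lincomb c x ⊕ lincomb (λ i → δ i j) x     ≡⟨ lincomb-⊕ c _ x ⟨
  lincomb (λ i → c i xor δ i j) x ∎
  where open ≡-Reasoning

Span : ∀ {v n} → (Fin n → Subset v) → Subset v → Set
Span {n = n} x u = Σ (Fin n → Bool) λ c → u ≡ lincomb c x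

span-zero : ∀ {v n} (x : Fin n → Subset v) → Span x ∅
span-zero x = (λ _ → false) , sym (lincomb-zero x)

span-⊕ : ∀ {v n} (x : Fin n → Subset v) {u u'} → Span x u → Span x u' → Span x (u ⊕ u')
span-⊕ x (c , refl) (c' , refl) = (λ i → c i xor c' i) , sym (lincomb-⊕ c c' x)

span-· : ∀ {v n} (x : Fin n → Subset v) b {u} → Span x u → Span x (b · u)
span-· x true  s = s
span-· x false s = span-zero x

span-gen : ∀ {v n} (x : Fin n → Subset v) j → Span x (x j)
span-gen x j = (λ i → δ i j) , sym (lincomb-δ x j)

span-trans : ∀ {v n m} (x : Fin n → Subset v) {z : Fin m → Subset v} →
             (∀ i → Span x (z i)) → ∀ {u} → Span z u → Span x u
span-trans x {z} z⊆x (c , refl) = go z z⊆x c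
  where
  go : ∀ {m} (z : Fin m → Subset _) → (∀ i → Span x (z i)) → (c : Fin m → Bool) → Span x (lincomb c z)
  go {zero}  z z⊆x c = span-zero x
  go {suc m} z z⊆x c = subst (Span x) (sym (lincomb-suc c z))
    (span-⊕ x (span-· x (c zero) (z⊆x zero)) (go (z ∘ suc) (z⊆x ∘ suc) (c ∘ suc)))

SameSpan : ∀ {v n m} → (Fin n → Subset v) → (Fin m → Subset v) → Set
SameSpan x y = (∀ i → Span x (y i)) × (∀ i → Span y (x i))

affine-span-transfer : ∀ {v n m} {𝒯 : Family v} {w} {x : Fin n → Subset v} {y : Fin m → Subset v} →
                       SameSpan x y → IsAffineSpan 𝒯 w x → IsAffineSpan 𝒯 w y
affine-span-transfer {w = w} {x} {y} (y⊆x , x⊆y) span u =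
  mk⇔ (λ h → move x⊆y (Equivalence.to (span u) h)) (λ h → Equivalence.from (span u) (move y⊆x h))
  where
  move : ∀ {n m} {a : Fin n → Subset _} {b : Fin m → Subset _} →
         (∀ i → Span b (a i)) → InAffine w a u → InAffine w b u
  move {a = a} {b} a⊆b (c , refl) with span-trans b a⊆b (c , refl)
  ... | c' , e = c' , cong (w ⊕_) e

nonzero-coordinate : ∀ {v} (u : Subset v) → u ≢ ∅ → Σ (Fin v) λ k → lookup u k ≡ true
nonzero-coordinate u u≢∅ with nonempty? u
... | yes (k , k∈u) = k , []=⇒lookup k∈u
... | no  ¬nonempty = ⊥-elim (u≢∅ (Empty-unique ¬nonempty))

indep⇒nonzero : ∀ {v n} (x : Fin n → Subset v) → LinIndep x → ∀ i → x i ≢ ∅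
indep⇒nonzero x indep i x≡∅ =
  contradiction (trans (sym (δ-diag i)) (indep _ (trans (lincomb-δ x i) x≡∅) i)) λ ()

indep-tail : ∀ {v n} (x : Fin (suc n) → Subset v) → LinIndep x → LinIndep (x ∘ suc)
indep-tail x indep c e i = indep (false ◂ c) (trans (⊕-identityˡ _) e) (suc i)

indep-head : ∀ {v n} (x : Fin (suc n) → Subset v) → LinIndep x → ¬ Span (x ∘ suc) (x zero)
indep-head x indep (c , e)
  with indep (true ◂ c) (trans (cong (_⊕ lincomb c (x ∘ suc)) e) (⊕-self _)) zero
... | ()

Pivots : ∀ {v n} → (Fin n → Subset v) → (Fin n → Fin v) → Set
Pivots x p = ∀ i j → lookup (x i) (p j) ≡ δ i j

lincomb-at-pivot : ∀ {v n} {x : Fin n → Subset v} {p} → Pivots x p →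
                   ∀ c j → lookup (lincomb c x) (p j) ≡ c j
lincomb-at-pivot {x = x} {p} piv c j =
  trans (lookup-lincomb c x (p j)) (trans (sum-cong-≗ λ i → cong (c i ∧_) (piv i j)) (∑-δʳ c j))

pivots⇒indep : ∀ {v n} {x : Fin n → Subset v} {p} → Pivots x p → LinIndep x
pivots⇒indep {p = p} piv c e j =
  trans (sym (lincomb-at-pivot piv c j)) (trans (cong (λ u → lookup u (p j)) e) (lookup-∅ (p j)))

reduce : ∀ {v n} → (Fin n → Subset v) → (Fin n → Fin v) → Subset v → Subset v
reduce y p u = u ⊕ lincomb (λ j → lookup u (p j)) y

reduce-at-pivot : ∀ {v n} {y : Fin n → Subset v} {p} → Pivots y p →
                  ∀ u j → lookup (reduce y p u) (p j) ≡ false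
reduce-at-pivot {y = y} {p} piv u j =
  trans (lookup-⊕ u _ (p j))
        (trans (cong (lookup u (p j) xor_) (lincomb-at-pivot piv _ j)) (xor-same (lookup u (p j))))

adjoin : ∀ {v n} {y : Fin n → Subset v} {p} {z k} → Pivots y p →
         lookup z k ≡ true → (∀ j → lookup z (p j) ≡ false) →
         Pivots (z ◂ λ i → y i ⊕ lookup (y i) k · z) (k ◂ p)
adjoin piv zk zp zero    zero    = zk
adjoin piv zk zp zero    (suc j) = zp j
adjoin {y = y} {p} {z} {k} piv zk zp (suc i) zero = begin
  lookup (y i ⊕ b · z) k            ≡⟨ lookup-⊕ (y i) (b · z) k ⟩
  b xor lookup (b · z) k            ≡⟨ cong (b xor_) (trans (lookup-· b z k) (cong (b ∧_) zk)) ⟩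
  b xor (b ∧ true)                  ≡⟨ cong (b xor_) (∧-identityʳ b) ⟩
  b xor b                           ≡⟨ xor-same b ⟩
  false                             ∎
  where open ≡-Reasoning
        b = lookup (y i) k
adjoin {y = y} {p} {z} {k} piv zk zp (suc i) (suc j) = begin
  lookup (y i ⊕ b · z) (p j)        ≡⟨ lookup-⊕ (y i) (b · z) (p j) ⟩
  lookup (y i) (p j) xor lookup (b · z) (p j)
    ≡⟨ cong₂ _xor_ (piv i j) (trans (lookup-· b z (p j)) (cong (b ∧_) (zp j))) ⟩
  δ i j xor (b ∧ false)             ≡⟨ cong (δ i j xor_) (∧-zeroʳ b) ⟩
  δ i j xor false                   ≡⟨ xor-identityʳ (δ i j) ⟩
  δ i j                             ∎
  where open ≡-Reasoning
        b = lookup (y i) k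

reduced-basis : ∀ {v n} (x : Fin n → Subset v) → LinIndep x →
                Σ (Fin n → Subset v) λ y → Σ (Fin n → Fin v) λ p → Pivots y p × SameSpan x y
reduced-basis {n = zero} x _ = x , (λ ()) , (λ ()) , (λ ()) , (λ ())
reduced-basis {v} {suc n} x indep with reduced-basis (x ∘ suc) (indep-tail x indep)
... | y , p , piv , (y⊆x′ , x′⊆y) =
  new , (k ◂ p) , adjoin piv zk (reduce-at-pivot piv (x zero)) , (new⊆x , x⊆new)
  where
  d : Fin n → Bool
  d j = lookup (x zero) (p j)

  z : Subset v
  z = reduce y p (x zero)

  -- z ⊕ lincomb d y = x zero, so z ≠ ∅ because x zero is not in the span of the others.
  z≢∅ : z ≢ ∅
  z≢∅ z≡∅ = indep-head x indep (span-trans (x ∘ suc) y⊆x′ (d , x₀≡))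
    where
    x₀≡ : x zero ≡ lincomb d y
    x₀≡ = trans (sym (⊕-cancelʳ (x zero) (lincomb d y)))
                (trans (cong (_⊕ lincomb d y) z≡∅) (⊕-identityˡ (lincomb d y)))

  k : Fin v
  k = proj₁ (nonzero-coordinate z z≢∅)

  zk : lookup z k ≡ true
  zk = proj₂ (nonzero-coordinate z z≢∅)

  new : Fin (suc n) → Subset v
  new = z ◂ λ i → y i ⊕ lookup (y i) k · z

  from-tail : ∀ {u} → Span (x ∘ suc) u → Span x u
  from-tail = span-trans x (λ i → span-gen x (suc i))

  z∈x : Span x z
  z∈x = span-⊕ x (span-gen x zero) (from-tail (span-trans (x ∘ suc) y⊆x′ (d , refl)))

  new⊆x : ∀ i → Span x (new i)
  new⊆x zero    = z∈x
  new⊆x (suc i) = span-⊕ x (from-tail (y⊆x′ i)) (span-· x (lookup (y i) k) z∈x)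

  y⊆new : ∀ i → Span new (y i)
  y⊆new i = subst (Span new) (⊕-cancelʳ (y i) (lookup (y i) k · z))
    (span-⊕ new (span-gen new (suc i)) (span-· new (lookup (y i) k) (span-gen new zero)))

  x⊆new : ∀ i → Span new (x i)
  x⊆new zero    = subst (Span new) (⊕-cancelʳ (x zero) (lincomb d y))
    (span-⊕ new (span-gen new zero) (span-trans new y⊆new (d , refl)))
  x⊆new (suc i) = span-trans new y⊆new (x′⊆y i)

module AffineSpan {v n} {𝒯 : Family v} {w : Subset v} {x : Fin n → Subset v}
                  (span : IsAffineSpan 𝒯 w x) where

  member : ∀ c → 𝒯 (w ⊕ lincomb c x) ≡ true
  member c = Equivalence.to T-≡ (Equivalence.from (span _) (c , refl))

  member-elim : ∀ {y} → 𝒯 y ≡ true → Σ (Fin n → Bool) λ c → y ≡ w ⊕ lincomb c x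
  member-elim {y} e = Equivalence.to (span y) (Equivalence.from T-≡ e)

  shift-member : ∀ {y} j → 𝒯 y ≡ true → 𝒯 (y ⊕ x j) ≡ true
  shift-member j e with member-elim e
  ... | c , refl = subst (λ u → 𝒯 u ≡ true)
    (sym (trans (⊕-assoc w (lincomb c x) (x j)) (cong (w ⊕_) (lincomb-flip c x j))))
    (member _)

  shift-member-· : ∀ {y} b j → 𝒯 y ≡ true → 𝒯 (y ⊕ b · x j) ≡ true
  shift-member-· true  j e = shift-member j e
  shift-member-· {y} false j e = subst (λ u → 𝒯 u ≡ true) (sym (⊕-identityʳ y)) e

  shift-invariant : ∀ y j → 𝒯 (y ⊕ x j) ≡ 𝒯 y
  shift-invariant y j = ⇔→≡ (mk⇔ back (shift-member j))
    where
    back : 𝒯 (y ⊕ x j) ≡ true → 𝒯 y ≡ true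
    back e = subst (λ u → 𝒯 u ≡ true) (⊕-cancelʳ y (x j)) (shift-member j e)

  module Coordinates {p : Fin n → Fin v} (piv : Pivots x p) where

    point : (Fin n → Bool) → Subset v
    point d = w ⊕ lincomb (λ m → lookup w (p m) xor d m) x

    point-member : ∀ d → 𝒯 (point d) ≡ true
    point-member d = member _

    point-at-pivot : ∀ d m → lookup (point d) (p m) ≡ d m
    point-at-pivot d m = trans (lookup-⊕ w _ (p m))
      (trans (cong (lookup w (p m) xor_) (lincomb-at-pivot piv _ m))
             (xor-cancelˡ (lookup w (p m)) (d m)))

    point-of : ∀ {y} → 𝒯 y ≡ true → y ≡ point (λ m → lookup y (p m))
    point-of e with member-elim e
    ... | c , refl = cong (w ⊕_) (lincomb-cong x λ m → sym (begin
      lookup w (p m) xor lookup (w ⊕ lincomb c x) (p m)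
        ≡⟨ cong (lookup w (p m) xor_) (lookup-⊕ w (lincomb c x) (p m)) ⟩
      lookup w (p m) xor (lookup w (p m) xor lookup (lincomb c x) (p m))
        ≡⟨ xor-cancelˡ (lookup w (p m)) _ ⟩
      lookup (lincomb c x) (p m)
        ≡⟨ lincomb-at-pivot piv c m ⟩
      c m ∎))
      where open ≡-Reasoning

    pivot-injective : ∀ {y y'} → 𝒯 y ≡ true → 𝒯 y' ≡ true →
                      (∀ m → lookup y (p m) ≡ lookup y' (p m)) → y ≡ y'
    pivot-injective e e' agree =
      trans (point-of e) (trans (cong (w ⊕_) (lincomb-cong x λ m → cong (lookup w (p m) xor_) (agree m)))
                                (sym (point-of e')))

ind : Bool → ℕ
ind true  = 1
ind false = 0

cubeSum : ∀ {v} → (Subset v → ℕ) → ℕ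
cubeSum {zero}  g = g []
cubeSum {suc v} g = cubeSum (g ∘ (false ∷_)) + cubeSum (g ∘ (true ∷_))

cubeSum-cong : ∀ {v} {g h : Subset v → ℕ} → (∀ y → g y ≡ h y) → cubeSum g ≡ cubeSum h
cubeSum-cong {zero}  g≗h = g≗h []
cubeSum-cong {suc v} g≗h = cong₂ _+_ (cubeSum-cong (g≗h ∘ (false ∷_))) (cubeSum-cong (g≗h ∘ (true ∷_)))

cubeSum-zero : ∀ {v} (g : Subset v → ℕ) → (∀ y → g y ≡ 0) → cubeSum g ≡ 0
cubeSum-zero {zero}  g g≡0 = g≡0 []
cubeSum-zero {suc v} g g≡0 =
  cong₂ _+_ (cubeSum-zero _ (g≡0 ∘ (false ∷_))) (cubeSum-zero _ (g≡0 ∘ (true ∷_)))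

cubeSum-+ : ∀ {v} (g h : Subset v → ℕ) → cubeSum (λ y → g y + h y) ≡ cubeSum g + cubeSum h
cubeSum-+ {zero}  g h = refl
cubeSum-+ {suc v} g h = trans
  (cong₂ _+_ (cubeSum-+ (g ∘ (false ∷_)) (h ∘ (false ∷_))) (cubeSum-+ (g ∘ (true ∷_)) (h ∘ (true ∷_))))
  (+-interchange (cubeSum (g ∘ (false ∷_))) (cubeSum (h ∘ (false ∷_))) _ _)

cubeSum-translate : ∀ {v} (g : Subset v → ℕ) (m : Subset v) → cubeSum (λ y → g (y ⊕ m)) ≡ cubeSum g
cubeSum-translate {zero}  g []          = refl
cubeSum-translate {suc v} g (false ∷ m) =
  cong₂ _+_ (cubeSum-translate (g ∘ (false ∷_)) m) (cubeSum-translate (g ∘ (true ∷_)) m)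
cubeSum-translate {suc v} g (true ∷ m)  =
  trans (cong₂ _+_ (cubeSum-translate (g ∘ (true ∷_)) m) (cubeSum-translate (g ∘ (false ∷_)) m))
        (+-comm (cubeSum (g ∘ (true ∷_))) _)

_≟ᵥ_ : ∀ {v} (a b : Subset v) → Dec (a ≡ b)
_≟ᵥ_ = ≡-dec _≟ᵇ_

cubeSum-point : ∀ {v} (q : Subset v) n → cubeSum (λ y → if does (y ≟ᵥ q) then n else 0) ≡ n
cubeSum-point []          n = refl
cubeSum-point (false ∷ q) n =
  trans (cong₂ _+_ (cubeSum-point q n)
                   (cubeSum-zero (λ y → if does ((true ∷ y) ≟ᵥ (false ∷ q)) then n else 0) λ _ → refl))
        (+-identityʳ n)
cubeSum-point (true ∷ q)  n =
  cong₂ _+_ (cubeSum-zero (λ y → if does ((false ∷ y) ≟ᵥ (true ∷ q)) then n else 0) λ _ → refl)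
            (cubeSum-point q n)

cubeSum-support : ∀ {v} (g : Subset v → ℕ) (L : List (Subset v)) → Unique L →
                  (∀ y → y ∉ₗ L → g y ≡ 0) → cubeSum g ≡ sum (map g L)
cubeSum-support g []      []               vanish = cubeSum-zero g λ y → vanish y λ ()
cubeSum-support g (q ∷ L) (q∉L ∷ unique) vanish = begin
  cubeSum g                      ≡⟨ cubeSum-cong split ⟩
  cubeSum (λ y → at-q y + g′ y)  ≡⟨ cubeSum-+ at-q g′ ⟩
  cubeSum at-q + cubeSum g′
    ≡⟨ cong₂ _+_ (cubeSum-point q (g q)) (cubeSum-support g′ L unique vanish′) ⟩
  g q + sum (map g′ L)           ≡⟨ cong (λ l → g q + sum l) (map-cong-local (All.map agree q∉L)) ⟩
  g q + sum (map g L)            ∎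
  where
  open ≡-Reasoning
  at-q g′ : Subset _ → ℕ
  at-q y = if does (y ≟ᵥ q) then g q else 0
  g′   y = if does (y ≟ᵥ q) then 0 else g y

  split : ∀ y → g y ≡ at-q y + g′ y
  split y with y ≟ᵥ q
  ... | yes refl = sym (+-identityʳ (g q))
  ... | no  _    = refl

  vanish′ : ∀ y → y ∉ₗ L → g′ y ≡ 0
  vanish′ y y∉L with y ≟ᵥ q
  ... | yes _   = refl
  ... | no  y≢q = vanish y λ { (hereₗ y≡q) → y≢q y≡q ; (thereₗ y∈L) → y∉L y∈L }

  agree : ∀ {z} → q ≢ z → g′ z ≡ g z
  agree {z} q≢z with z ≟ᵥ q
  ... | yes z≡q = ⊥-elim (q≢z (sym z≡q))
  ... | no  _   = refl

length-filter : ∀ {A : Set} {P : Pred A 0ℓ} (P? : Decidable P) xs →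
                length (filter P? xs) ≡ sum (map (ind ∘ does ∘ P?) xs)
length-filter P? []       = refl
length-filter P? (x ∷ xs) with does (P? x)
... | true  = cong suc (length-filter P? xs)
... | false = length-filter P? xs

sum-allSubsets : ∀ {v} (g : Subset v → ℕ) → sum (map g (allSubsets v)) ≡ cubeSum g
sum-allSubsets {zero}  g = +-identityʳ (g [])
sum-allSubsets {suc v} g = begin
  sum (map g (map (false ∷_) S ++ map (true ∷_) S))
    ≡⟨ cong sum (map-++ g (map (false ∷_) S) _) ⟩
  sum (map g (map (false ∷_) S) ++ map g (map (true ∷_) S))
    ≡⟨ sum-++ (map g (map (false ∷_) S)) _ ⟩
  sum (map g (map (false ∷_) S)) + sum (map g (map (true ∷_) S))
    ≡⟨ cong₂ (λ l l′ → sum l + sum l′) (map-∘ S) (map-∘ S) ⟨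
  sum (map (g ∘ (false ∷_)) S) + sum (map (g ∘ (true ∷_)) S)
    ≡⟨ cong₂ _+_ (sum-allSubsets (g ∘ (false ∷_))) (sum-allSubsets (g ∘ (true ∷_))) ⟩
  cubeSum g ∎
  where
  open ≡-Reasoning
  S = allSubsets v

countContaining-cubeSum : ∀ {v} (F : Family v) s →
                          countContaining F s ≡ cubeSum (λ y → ind (does (s ⊆? y) ∧ F y))
countContaining-cubeSum {v} F s =
  trans (length-filter (λ y → T? (F y) ×-dec (s ⊆? y)) (allSubsets v))
        (trans (sum-allSubsets (λ y → ind (F y ∧ does (s ⊆? y))))
               (cubeSum-cong λ y → cong ind (∧-comm (F y) _)))

∣p∪q∣≤∣p∣+∣q∣ : ∀ {n} (p q : Subset n) → ∣ p ∪ q ∣ ≤ ∣ p ∣ + ∣ q ∣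
∣p∪q∣≤∣p∣+∣q∣ []          []          = z≤n
∣p∪q∣≤∣p∣+∣q∣ (true ∷ p)  (b ∷ q)     =
  s≤s (≤-trans (∣p∪q∣≤∣p∣+∣q∣ p q) (+-monoʳ-≤ ∣ p ∣ (∣p∣≤∣x∷p∣ b q)))
∣p∪q∣≤∣p∣+∣q∣ (false ∷ p) (true ∷ q)  =
  ≤-trans (s≤s (∣p∪q∣≤∣p∣+∣q∣ p q)) (≤-reflexive (sym (+-suc ∣ p ∣ ∣ q ∣)))
∣p∪q∣≤∣p∣+∣q∣ (false ∷ p) (false ∷ q) = ∣p∪q∣≤∣p∣+∣q∣ p q

∣p∪⁅x⁆∣≤1+∣p∣ : ∀ {n} (p : Subset n) x → ∣ p ∪ ⁅ x ⁆ ∣ ≤ suc ∣ p ∣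
∣p∪⁅x⁆∣≤1+∣p∣ p x = ≤-trans (∣p∪q∣≤∣p∣+∣q∣ p ⁅ x ⁆)
  (≤-reflexive (trans (cong (∣ p ∣ +_) (∣⁅x⁆∣≡1 x)) (+-comm ∣ p ∣ 1)))

x∉p-x : ∀ {n} (p : Subset n) {x : Fin n} → x ∉ p - x
x∉p-x (b ∷ p) {zero}  ()
x∉p-x (b ∷ p) {suc x} (there x∈p-x) = x∉p-x p x∈p-x

image : ∀ {n v} → (Fin n → Fin v) → Subset n → Subset v
image p []          = ∅
image p (true ∷ S)  = ⁅ p zero ⁆ ∪ image (p ∘ suc) S
image p (false ∷ S) = image (p ∘ suc) S

image-card : ∀ {n v} (p : Fin n → Fin v) S → ∣ image p S ∣ ≤ ∣ S ∣
image-card {v = v} p [] = ≤-reflexive (∣⊥∣≡0 v)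
image-card p (true ∷ S)  = ≤-trans (∣p∪q∣≤∣p∣+∣q∣ ⁅ p zero ⁆ (image (p ∘ suc) S))
  (subst (λ c → c + ∣ image (p ∘ suc) S ∣ ≤ suc ∣ S ∣) (sym (∣⁅x⁆∣≡1 (p zero)))
         (s≤s (image-card (p ∘ suc) S)))
image-card p (false ∷ S) = image-card (p ∘ suc) S

image⁺ : ∀ {n v} (p : Fin n → Fin v) S {m} → m ∈ S → p m ∈ image p S
image⁺ p (true ∷ S)  here          = x∈p∪q⁺ (inj₁ (x∈⁅x⁆ (p zero)))
image⁺ p (true ∷ S)  (there m∈S)   = x∈p∪q⁺ (inj₂ (image⁺ (p ∘ suc) S m∈S))
image⁺ p (false ∷ S) (there m∈S)   = image⁺ (p ∘ suc) S m∈S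

image⁻ : ∀ {n v} (p : Fin n → Fin v) S {k} → k ∈ image p S → Σ (Fin n) λ m → m ∈ S × p m ≡ k
image⁻ p []          k∈ = ⊥-elim (∉⊥ k∈)
image⁻ p (true ∷ S)  k∈ with x∈p∪q⁻ ⁅ p zero ⁆ (image (p ∘ suc) S) k∈
... | inj₁ k∈⁅p₀⁆ = zero , here , sym (x∈⁅y⁆⇒x≡y (p zero) k∈⁅p₀⁆)
... | inj₂ k∈img with image⁻ (p ∘ suc) S k∈img
...   | m , m∈S , pm≡k = suc m , there m∈S , pm≡k
image⁻ p (false ∷ S) k∈ with image⁻ (p ∘ suc) S k∈
... | m , m∈S , pm≡k = suc m , there m∈S , pm≡k

does-reflect : ∀ {A : Set} (a? : Dec A) {b : Bool} → (A → b ≡ true) → (b ≡ true → A) → does a? ≡ b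
does-reflect a? {true}  _    b⇒a = dec-true a? (b⇒a refl)
does-reflect a? {false} a⇒b _    = dec-false a? λ a → contradiction (a⇒b a) λ ()

∪⁅⁆⊆⇔ : ∀ {n} {s y : Subset n} {z} → s ⊆ y → (s ∪ ⁅ z ⁆ ⊆ y ⇔ z ∈ y)
∪⁅⁆⊆⇔ {s = s} {y} {z} s⊆y = mk⇔ (λ h → h (x∈p∪q⁺ (inj₂ (x∈⁅x⁆ z))))
  (λ z∈y {k} k∈ → [ s⊆y , (λ k∈⁅z⁆ → subst (_∈ y) (sym (x∈⁅y⁆⇒x≡y z k∈⁅z⁆)) z∈y) ]′ (x∈p∪q⁻ s ⁅ z ⁆ k∈))

∉⇒lookup : ∀ {v} {k : Fin v} {u : Subset v} → k ∉ u → lookup u k ≡ false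
∉⇒lookup {k = k} {u} k∉u with lookup u k in e
... | true  = ⊥-elim (k∉u (lookup⇒[]= k u e))
... | false = refl

injection-bound : ∀ {n v} (s : Subset v) (g : Fin n → Fin v) → Injective _≡_ _≡_ g →
                  (∀ i → g i ∈ s) → n ≤ ∣ s ∣
injection-bound {zero}  s g inj g∈s = z≤n
injection-bound {suc n} s g inj g∈s = ≤-trans
  (s≤s (injection-bound (s - g zero) (g ∘ suc) (suc-injective ∘ inj)
                        (λ i → x∈p∧x≢y⇒x∈p-y (g∈s (suc i)) (λ e → 0≢1+n (sym (inj e))))))
  (x∈p⇒∣p-x∣<∣p∣ (g∈s zero))

-- Nonzero pairwise disjoint vectors have pivots: pick any point of each vector.
disjoint⇒pivots : ∀ {v n} {x : Fin n → Subset v} → (∀ i → x i ≢ ∅) → PairwiseDisjoint x →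
                  Σ (Fin n → Fin v) (Pivots x)
disjoint⇒pivots {x = x} nonzero disjoint = p , piv
  where
  p : Fin _ → Fin _
  p i = proj₁ (nonzero-coordinate (x i) (nonzero i))

  p∈x : ∀ i → lookup (x i) (p i) ≡ true
  p∈x i = proj₂ (nonzero-coordinate (x i) (nonzero i))

  piv : Pivots x p
  piv i j with i ≟ j
  ... | yes refl = p∈x i
  ... | no  i≢j  = begin
    lookup (x i) (p j)                        ≡⟨ ∧-identityʳ _ ⟨
    lookup (x i) (p j) ∧ true                 ≡⟨ cong (lookup (x i) (p j) ∧_) (p∈x j) ⟨
    lookup (x i) (p j) ∧ lookup (x j) (p j)   ≡⟨ lookup-∩ (x i) (x j) (p j) ⟨
    lookup (x i ∩ x j) (p j)                  ≡⟨ cong (λ u → lookup u (p j)) (disjoint i j i≢j) ⟩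
    lookup ∅ (p j)                            ≡⟨ lookup-∅ (p j) ⟩
    false                                     ∎
    where open ≡-Reasoning

missed-block : ∀ {v t} (x : Fin (suc t) → Subset v) → PairwiseDisjoint x →
               ∀ s → ∣ s ∣ ≤ t → Σ (Fin (suc t)) λ j → s ∩ x j ≡ ∅
missed-block {t = t} x disjoint s ∣s∣≤t with all? (λ j → nonempty? (s ∩ x j))
... | no ¬all with ¬∀⟶∃¬ (suc t) _ (λ j → nonempty? (s ∩ x j)) ¬all
...   | j , empty = j , Empty-unique empty
missed-block {t = t} x disjoint s ∣s∣≤t | yes meets =
  contradiction (≤-trans (injection-bound s g injective (λ j → proj₁ (g∈ j))) ∣s∣≤t) (n≮n t)
  where
  g : Fin (suc t) → Fin _
  g j = proj₁ (meets j)

  g∈ : ∀ j → g j ∈ s × g j ∈ x j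
  g∈ j = x∈p∩q⁻ s (x j) (proj₂ (meets j))

  injective : ∀ {i j} → g i ≡ g j → i ≡ j
  injective {i} {j} gi≡gj with i ≟ j
  ... | yes i≡j = i≡j
  ... | no  i≢j = ⊥-elim (∉⊥ (subst (g j ∈_) (disjoint i j i≢j)
                    (x∈p∩q⁺ (subst (_∈ x i) gi≡gj (proj₂ (g∈ i)) , proj₂ (g∈ j)))))

⊆-shift : ∀ {v} {s u : Subset v} → s ∩ u ≡ ∅ → ∀ y → s ⊆ y ⊕ u ⇔ s ⊆ y
⊆-shift {s = s} {u} s∩u≡∅ y =
  mk⇔ (λ h {k} k∈s → lookup⇒[]= k y (trans (sym (same k∈s)) ([]=⇒lookup (h k∈s))))
      (λ h {k} k∈s → lookup⇒[]= k (y ⊕ u) (trans (same k∈s) ([]=⇒lookup (h k∈s))))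
  where
  same : ∀ {k} → k ∈ s → lookup (y ⊕ u) k ≡ lookup y k
  same {k} k∈s = trans (lookup-⊕ y u k) (trans (cong (lookup y k xor_) u-off) (xor-identityʳ _))
    where
    u-off : lookup u k ≡ false
    u-off = trans (cong (_∧ lookup u k) (sym ([]=⇒lookup k∈s)))
                  (trans (sym (lookup-∩ s u k)) (trans (cong (λ z → lookup z k) s∩u≡∅) (lookup-∅ k)))

-- Sufficiency: a disjoint basis splits 𝒯 into a trade by the parity of the coordinates.
module DisjointBasis {v t} {𝒯 : Family v} {w : Subset v} {x : Fin (suc t) → Subset v}
                     (indep : LinIndep x) (disjoint : PairwiseDisjoint x)
                     (span : IsAffineSpan 𝒯 w x) where
  open AffineSpan {x = x} span using (shift-invariant)

  p : Fin (suc t) → Fin v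
  p = proj₁ (disjoint⇒pivots (indep⇒nonzero x indep) disjoint)

  piv : Pivots x p
  piv = proj₂ (disjoint⇒pivots (indep⇒nonzero x indep) disjoint)

  -- The parity of the number of pivots contained in y; adding x j flips exactly one of them.
  parity : Subset v → Bool
  parity y = ∑ λ m → lookup y (p m)

  parity-shift : ∀ y j → parity (y ⊕ x j) ≡ not (parity y)
  parity-shift y j = begin
    ∑ (λ m → lookup (y ⊕ x j) (p m))
      ≡⟨ sum-cong-≗ (λ m → trans (lookup-⊕ y (x j) (p m)) (cong (lookup y (p m) xor_) (piv j m))) ⟩
    ∑ (λ m → lookup y (p m) xor δ j m)
      ≡⟨ ∑-distrib-+ (λ m → lookup y (p m)) (δ j) ⟩
    parity y xor ∑ (δ j)
      ≡⟨ cong (parity y xor_) (∑-δ-row j) ⟩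
    parity y xor true
      ≡⟨ xor-comm (parity y) true ⟩
    not (parity y) ∎
    where open ≡-Reasoning

  T₀ T₁ : Family v
  T₀ y = 𝒯 y ∧ parity y
  T₁ y = 𝒯 y ∧ not (parity y)

  T₀-shift : ∀ y j → T₀ (y ⊕ x j) ≡ T₁ y
  T₀-shift y j = cong₂ _∧_ (shift-invariant y j) (parity-shift y j)

  trade : IsTrade t T₀ T₁
  trade = disjoint-halves , balanced
    where
    disjoint-halves : ∀ y → ¬ (T (T₀ y) × T (T₁ y))
    disjoint-halves y with 𝒯 y | parity y
    ... | true  | true  = λ ()
    ... | true  | false = λ ()
    ... | false | _     = λ ()

    -- s misses some block x j, and translation by x j matches the members of T₀ containing s
    -- with the members of T₁ containing s.
    balanced : ∀ i → i ≤ t → ∀ s → ∣ s ∣ ≡ i → countContaining T₀ s ≡ countContaining T₁ s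
    balanced i i≤t s refl with missed-block x disjoint s i≤t
    ... | j , s∩xj≡∅ = begin
      countContaining T₀ s
        ≡⟨ countContaining-cubeSum T₀ s ⟩
      cubeSum (λ y → ind (does (s ⊆? y) ∧ T₀ y))
        ≡⟨ cubeSum-translate (λ y → ind (does (s ⊆? y) ∧ T₀ y)) (x j) ⟨
      cubeSum (λ y → ind (does (s ⊆? (y ⊕ x j)) ∧ T₀ (y ⊕ x j)))
        ≡⟨ cubeSum-cong (λ y → cong ind (cong₂ _∧_ (contains-shift y) (T₀-shift y j))) ⟩
      cubeSum (λ y → ind (does (s ⊆? y) ∧ T₁ y))
        ≡⟨ countContaining-cubeSum T₁ s ⟨
      countContaining T₁ s ∎
      where
      open ≡-Reasoning
      contains-shift : ∀ y → does (s ⊆? (y ⊕ x j)) ≡ does (s ⊆? y)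
      contains-shift y = does-⇔ (⊆-shift s∩xj≡∅ y) (s ⊆? (y ⊕ x j)) (s ⊆? y)

  union : UnionIs T₀ T₁ 𝒯
  union y with 𝒯 y | parity y
  ... | true  | true  = refl
  ... | true  | false = refl
  ... | false | _     = refl

𝔽₂² : List (Bool × Bool)
𝔽₂² = (false , false) ∷ (false , true) ∷ (true , false) ∷ (true , true) ∷ []

𝔽₂²-unique : Unique 𝔽₂²
𝔽₂²-unique = ((λ ()) ∷ (λ ()) ∷ (λ ()) ∷ []) ∷ ((λ ()) ∷ (λ ()) ∷ []) ∷ ((λ ()) ∷ []) ∷ [] ∷ []

count₄ : (Bool → Bool → Bool) → ℕ
count₄ h = sum (map (uncurry λ a b → ind (h a b)) 𝔽₂²)

record Balanced (u f : Bool → Bool → Bool) : Set where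
  constructor balanced
  field balance : count₄ (λ a b → f a b ∧ u a b) ≡ count₄ (λ a b → f a b ∧ not (u a b))

count₄-cong : ∀ {h h′} → (∀ a b → h a b ≡ h′ a b) → count₄ h ≡ count₄ h′
count₄-cong h≗h′ = cong₂ _+_ (cong ind (h≗h′ false false)) (cong₂ _+_ (cong ind (h≗h′ false true))
                     (cong₂ _+_ (cong ind (h≗h′ true false)) (cong (λ b → ind b + 0) (h≗h′ true true))))

Balanced-cong : ∀ {u f g} → (∀ a b → f a b ≡ g a b) → Balanced u f → Balanced u g
Balanced-cong {u} f≗g (balanced balance) = balanced
  (trans (count₄-cong λ a b → cong (_∧ u a b) (sym (f≗g a b)))
         (trans balance (count₄-cong λ a b → cong (_∧ not (u a b)) (f≗g a b))))

colouring : Bool → Bool → Bool → Bool → Bool → Bool → Bool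
colouring u₀₀ u₀₁ u₁₀ u₁₁ false false = u₀₀
colouring u₀₀ u₀₁ u₁₀ u₁₁ false true  = u₀₁
colouring u₀₀ u₀₁ u₁₀ u₁₁ true  false = u₁₀
colouring u₀₀ u₀₁ u₁₀ u₁₁ true  true  = u₁₁

-- The theorem below, checked on the 32 possible value tables (with β).
no-balanced-table : ∀ u₀₀ u₀₁ u₁₀ u₁₁ β → let u = colouring u₀₀ u₀₁ u₁₀ u₁₁ in
  Balanced u (λ _ _ → true) → Balanced u (λ _ b → b) → Balanced u (λ a _ → a) →
  Balanced u (λ a b → β xor (a xor b)) → ⊥
no-balanced-table _     true  _     true  _     _ (balanced ()) _ _
no-balanced-table _     false true  true  _     _ _ (balanced ()) _
no-balanced-table false false false true  _     (balanced ()) _ _ _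
no-balanced-table true  false false true  false _ _ _ (balanced ())
no-balanced-table true  false false true  true  _ _ _ (balanced ())
no-balanced-table _     false _     false _     _ (balanced ()) _ _
no-balanced-table _     true  false false _     _ _ (balanced ()) _
no-balanced-table true  true  true  false _     (balanced ()) _ _ _
no-balanced-table false true  true  false false _ _ _ (balanced ())
no-balanced-table false true  true  false true  _ _ _ (balanced ())

tabulate₄ : ∀ {u f} → Balanced u f →
            Balanced (colouring (u false false) (u false true) (u true false) (u true true)) f
tabulate₄ (balanced balance) = balanced balance

-- No colouring is balanced on the plane, on the lines b = 1 and a = 1, and on a line
-- a + b = β + 1: balance on the first three forces u a b = c + a + b for a constant c,
-- which is monochromatic on each line a + b = const.
no-balanced-colouring : ∀ u β → Balanced u (λ _ _ → true) → Balanced u (λ _ b → b) →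
                        Balanced u (λ a _ → a) → Balanced u (λ a b → β xor (a xor b)) → ⊥
no-balanced-colouring u β plane line-b line-a diagonal =
  no-balanced-table _ _ _ _ β
    (tabulate₄ plane) (tabulate₄ line-b) (tabulate₄ line-a) (tabulate₄ diagonal)

module TradeOnPivotBasis {v t} {𝒯 : Family v} {w : Subset v} {x : Fin (suc t) → Subset v}
                         {p : Fin (suc t) → Fin v} (span : IsAffineSpan 𝒯 w x) (piv : Pivots x p)
                         {T₀ T₁ : Family v} (trade : IsTrade t T₀ T₁) (union : UnionIs T₀ T₁ 𝒯) where
  open AffineSpan {x = x} span using (shift-member-·)
  open AffineSpan.Coordinates {x = x} span piv
    using (point; point-member; point-at-pivot; pivot-injective)

  T₀⊆𝒯 : ∀ {y} → T₀ y ≡ true → 𝒯 y ≡ true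
  T₀⊆𝒯 {y} e = trans (sym (union y)) (cong (_∨ T₁ y) e)

  T₁⊆𝒯 : ∀ {y} → T₁ y ≡ true → 𝒯 y ≡ true
  T₁⊆𝒯 {y} e = trans (sym (union y)) (trans (cong (T₀ y ∨_) e) (∨-zeroʳ (T₀ y)))

  complementary : ∀ {y} → 𝒯 y ≡ true → T₁ y ≡ not (T₀ y)
  complementary {y} e with T₀ y in e₀ | T₁ y in e₁
  ... | true  | true  = ⊥-elim (proj₁ trade y (Equivalence.from T-≡ e₀ , Equivalence.from T-≡ e₁))
  ... | true  | false = refl
  ... | false | true  = refl
  ... | false | false = contradiction (trans (sym e) (trans (sym (union y)) (cong₂ _∨_ e₀ e₁))) λ ()

  -- Fix two distinct directions i ≠ j.  The points of 𝒯 that are one at all other pivots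
  -- form the plane of the four corners q a b.
  module Plane (i j : Fin (suc t)) (i≢j : i ≢ j) where

    others : Subset (suc t)
    others = ⊤ - i - j

    i∉others : i ∉ others
    i∉others i∈ = x∉p-x ⊤ (p─q⊆p (⊤ - i) ⁅ j ⁆ i∈)

    j∉others : j ∉ others
    j∉others = x∉p-x (⊤ - i)

    others⁺ : ∀ {m} → m ≢ i → m ≢ j → m ∈ others
    others⁺ m≢i m≢j = x∈p∧x≢y⇒x∈p-y (x∈p∧x≢y⇒x∈p-y ∈⊤ m≢i) m≢j

    others⁻ : ∀ {m} → m ∈ others → m ≢ i × m ≢ j
    others⁻ {m} m∈ = (λ { refl → i∉others m∈ }) , (λ { refl → j∉others m∈ })

    ∣others∣<t : suc ∣ others ∣ ≤ t
    ∣others∣<t = ≤-pred (≤-trans (s≤s (x∈p⇒∣p-x∣<∣p∣ j∈⊤-i))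
                                 (subst (suc ∣ ⊤ - i ∣ ≤_) (∣⊤∣≡n (suc t)) (x∈p⇒∣p-x∣<∣p∣ (∈⊤ {x = i}))))
      where j∈⊤-i : j ∈ ⊤ - i
            j∈⊤-i = x∈p∧x≢y⇒x∈p-y ∈⊤ (i≢j ∘ sym)

    base : Subset v
    base = point (lookup others)

    q : Bool → Bool → Subset v
    q a b = (base ⊕ a · x i) ⊕ b · x j

    q-member : ∀ a b → 𝒯 (q a b) ≡ true
    q-member a b = shift-member-· b j (shift-member-· a i (point-member (lookup others)))

    q-at-pivot : ∀ a b m → lookup (q a b) (p m) ≡ (lookup others m xor (a ∧ δ i m)) xor (b ∧ δ j m)
    q-at-pivot a b m = begin
      lookup ((base ⊕ a · x i) ⊕ b · x j) (p m)
        ≡⟨ lookup-⊕ (base ⊕ a · x i) (b · x j) (p m) ⟩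
      lookup (base ⊕ a · x i) (p m) xor lookup (b · x j) (p m)
        ≡⟨ cong₂ _xor_ (lookup-⊕ base (a · x i) (p m)) (lookup-· b (x j) (p m)) ⟩
      (lookup base (p m) xor lookup (a · x i) (p m)) xor (b ∧ lookup (x j) (p m))
        ≡⟨ cong₂ (λ c d → (c xor d) xor (b ∧ lookup (x j) (p m)))
                 (point-at-pivot (lookup others) m) (lookup-· a (x i) (p m)) ⟩
      (lookup others m xor (a ∧ lookup (x i) (p m))) xor (b ∧ lookup (x j) (p m))
        ≡⟨ cong₂ (λ c d → (lookup others m xor (a ∧ c)) xor (b ∧ d)) (piv i m) (piv j m) ⟩
      (lookup others m xor (a ∧ δ i m)) xor (b ∧ δ j m) ∎
      where open ≡-Reasoning

    q-at-i : ∀ a b → lookup (q a b) (p i) ≡ a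
    q-at-i a b rewrite q-at-pivot a b i | ∉⇒lookup i∉others | δ-diag i | δ-off (i≢j ∘ sym)
                     | ∧-identityʳ a | ∧-zeroʳ b = xor-identityʳ a

    q-at-j : ∀ a b → lookup (q a b) (p j) ≡ b
    q-at-j a b rewrite q-at-pivot a b j | ∉⇒lookup j∉others | δ-off i≢j | δ-diag j
                     | ∧-zeroʳ a | ∧-identityʳ b = refl

    q-at-others : ∀ a b {m} → m ∈ others → lookup (q a b) (p m) ≡ true
    q-at-others a b {m} m∈ with others⁻ m∈
    ... | m≢i , m≢j rewrite q-at-pivot a b m | []=⇒lookup m∈ | δ-off (m≢i ∘ sym) | δ-off (m≢j ∘ sym)
                          | ∧-zeroʳ a | ∧-zeroʳ b = refl

    q-at-shared : ∀ {k} → lookup (x i) k ≡ true → lookup (x j) k ≡ true →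
                  ∀ a b → lookup (q a b) k ≡ lookup base k xor (a xor b)
    q-at-shared {k} xik xjk a b = begin
      lookup ((base ⊕ a · x i) ⊕ b · x j) k
        ≡⟨ lookup-⊕ (base ⊕ a · x i) (b · x j) k ⟩
      lookup (base ⊕ a · x i) k xor lookup (b · x j) k
        ≡⟨ cong₂ _xor_ (lookup-⊕ base (a · x i) k) (lookup-· b (x j) k) ⟩
      (lookup base k xor lookup (a · x i) k) xor (b ∧ lookup (x j) k)
        ≡⟨ cong₂ (λ c d → (lookup base k xor c) xor d)
                 (trans (lookup-· a (x i) k) (trans (cong (a ∧_) xik) (∧-identityʳ a)))
                 (trans (cong (b ∧_) xjk) (∧-identityʳ b)) ⟩
      (lookup base k xor a) xor b
        ≡⟨ xor-assoc (lookup base k) a b ⟩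
      lookup base k xor (a xor b) ∎
      where open ≡-Reasoning

    s₀ : Subset v
    s₀ = image p others

    s₀⊆q : ∀ a b → s₀ ⊆ q a b
    s₀⊆q a b {k} k∈s₀ with image⁻ p others k∈s₀
    ... | m , m∈ , refl = lookup⇒[]= (p m) (q a b) (q-at-others a b m∈)

    on-plane : ∀ {y} → 𝒯 y ≡ true → s₀ ⊆ y → y ≡ q (lookup y (p i)) (lookup y (p j))
    on-plane {y} y∈𝒯 s₀⊆y = pivot-injective y∈𝒯 (q-member (lookup y (p i)) (lookup y (p j))) agree
      where
      agree : ∀ m → lookup y (p m) ≡ lookup (q (lookup y (p i)) (lookup y (p j))) (p m)
      agree m with m ≟ i | m ≟ j
      ... | yes refl | _        = sym (q-at-i (lookup y (p i)) (lookup y (p j)))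
      ... | no  _    | yes refl = sym (q-at-j (lookup y (p i)) (lookup y (p j)))
      ... | no  m≢i  | no  m≢j  = trans ([]=⇒lookup (s₀⊆y (image⁺ p others (others⁺ m≢i m≢j))))
        (sym (q-at-others (lookup y (p i)) (lookup y (p j)) (others⁺ m≢i m≢j)))

    corners : List (Subset v)
    corners = map (uncurry q) 𝔽₂²

    corners-unique : Unique corners
    corners-unique = map⁺ q-injective 𝔽₂²-unique
      where
      q-injective : ∀ {ab ab′} → uncurry q ab ≡ uncurry q ab′ → ab ≡ ab′
      q-injective {a , b} {a′ , b′} q≡ = cong₂ _,_
        (trans (sym (q-at-i a b)) (trans (cong (λ u → lookup u (p i)) q≡) (q-at-i a′ b′)))
        (trans (sym (q-at-j a b)) (trans (cong (λ u → lookup u (p j)) q≡) (q-at-j a′ b′)))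

    corners-cover : ∀ {y} → 𝒯 y ≡ true → s₀ ⊆ y → y ∈ₗ corners
    corners-cover {y} y∈𝒯 s₀⊆y with lookup y (p i) | lookup y (p j) | on-plane y∈𝒯 s₀⊆y
    ... | false | false | y≡ = hereₗ y≡
    ... | false | true  | y≡ = thereₗ (hereₗ y≡)
    ... | true  | false | y≡ = thereₗ (thereₗ (hereₗ y≡))
    ... | true  | true  | y≡ = thereₗ (thereₗ (thereₗ (hereₗ y≡)))

    count-on-plane : ∀ (F : Family v) → (∀ {y} → F y ≡ true → 𝒯 y ≡ true) → ∀ s → s₀ ⊆ s →
                     countContaining F s ≡ count₄ (λ a b → does (s ⊆? q a b) ∧ F (q a b))
    count-on-plane F F⊆𝒯 s s₀⊆s =
      trans (countContaining-cubeSum F s) (cubeSum-support _ corners corners-unique vanish)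
      where
      vanish : ∀ y → y ∉ₗ corners → ind (does (s ⊆? y) ∧ F y) ≡ 0
      vanish y y∉ with s ⊆? y | F y in Fy
      ... | yes s⊆y | true  = ⊥-elim (y∉ (corners-cover (F⊆𝒯 Fy) (⊆-trans s₀⊆s s⊆y)))
      ... | yes _   | false = refl
      ... | no  _   | _     = refl

    balanced-above : ∀ s → ∣ s ∣ ≤ t → s₀ ⊆ s → Balanced (λ a b → T₀ (q a b)) (λ a b → does (s ⊆? q a b))
    balanced-above s ∣s∣≤t s₀⊆s = balanced (begin
      count₄ (λ a b → does (s ⊆? q a b) ∧ T₀ (q a b))       ≡⟨ count-on-plane T₀ T₀⊆𝒯 s s₀⊆s ⟨
      countContaining T₀ s                                   ≡⟨ proj₂ trade ∣ s ∣ ∣s∣≤t s refl ⟩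
      countContaining T₁ s                                   ≡⟨ count-on-plane T₁ T₁⊆𝒯 s s₀⊆s ⟩
      count₄ (λ a b → does (s ⊆? q a b) ∧ T₁ (q a b))
        ≡⟨ count₄-cong (λ a b → cong (does (s ⊆? q a b) ∧_) (complementary (q-member a b))) ⟩
      count₄ (λ a b → does (s ⊆? q a b) ∧ not (T₀ (q a b))) ∎)
      where open ≡-Reasoning

    ∣s₀∣<t : suc ∣ s₀ ∣ ≤ t
    ∣s₀∣<t = ≤-trans (s≤s (image-card p others)) ∣others∣<t

    -- The test sets s₀ ∪ {z} have size ≤ t and detect the value of the corners at z.
    balanced-at : ∀ z → Balanced (λ a b → T₀ (q a b)) (λ a b → lookup (q a b) z)
    balanced-at z = Balanced-cong detects
      (balanced-above (s₀ ∪ ⁅ z ⁆) (≤-trans (∣p∪⁅x⁆∣≤1+∣p∣ s₀ z) ∣s₀∣<t) (p⊆p∪q ⁅ z ⁆))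
      where
      detects : ∀ a b → does (s₀ ∪ ⁅ z ⁆ ⊆? q a b) ≡ lookup (q a b) z
      detects a b = does-reflect (s₀ ∪ ⁅ z ⁆ ⊆? q a b)
        (λ ⊆q → []=⇒lookup (Equivalence.to (∪⁅⁆⊆⇔ (s₀⊆q a b)) ⊆q))
        (λ qz → Equivalence.from (∪⁅⁆⊆⇔ (s₀⊆q a b)) (lookup⇒[]= z (q a b) qz))

    no-shared-coordinate : ∀ {k} → lookup (x i) k ≡ true → lookup (x j) k ≡ true → ⊥
    no-shared-coordinate {k} xik xjk = no-balanced-colouring (λ a b → T₀ (q a b)) (lookup base k)
      (Balanced-cong (λ a b → dec-true (s₀ ⊆? q a b) (s₀⊆q a b))
                     (balanced-above s₀ (≤-trans (n≤1+n _) ∣s₀∣<t) ⊆-refl))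
      (Balanced-cong (λ a b → q-at-j a b) (balanced-at (p j)))
      (Balanced-cong (λ a b → q-at-i a b) (balanced-at (p i)))
      (Balanced-cong (λ a b → q-at-shared xik xjk a b) (balanced-at k))

  pairwise-disjoint : PairwiseDisjoint x
  pairwise-disjoint i j i≢j with nonempty? (x i ∩ x j)
  ... | no  empty      = Empty-unique empty
  ... | yes (k , k∈ij) with x∈p∩q⁻ (x i) (x j) k∈ij
  ...   | k∈i , k∈j = ⊥-elim (Plane.no-shared-coordinate i j i≢j ([]=⇒lookup k∈i) ([]=⇒lookup k∈j))

proposition1 : (v t : ℕ) (𝒯 : Family v) → IsAffineSubspaceOfDim (suc t) 𝒯 →
    ((Σ (Family v) λ T₀ → Σ (Family v) λ T₁ → IsTrade t T₀ T₁ × UnionIs T₀ T₁ 𝒯)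
     ⇔ (Σ (Subset v) λ w → Σ (Fin (suc t) → Subset v) λ x →
          LinIndep x × PairwiseDisjoint x × IsAffineSpan 𝒯 w x))
proposition1 v t 𝒯 (w , x , indep , span) = mk⇔ necessity sufficiency
  where
  necessity : (Σ (Family v) λ T₀ → Σ (Family v) λ T₁ → IsTrade t T₀ T₁ × UnionIs T₀ T₁ 𝒯) →
              Σ (Subset v) λ w → Σ (Fin (suc t) → Subset v) λ x →
                LinIndep x × PairwiseDisjoint x × IsAffineSpan 𝒯 w x
  necessity (T₀ , T₁ , trade , union) with reduced-basis x indep
  ... | y , p , piv , same = w , y , pivots⇒indep {x = y} piv , pairwise-disjoint , span′
    where
    span′ : IsAffineSpan 𝒯 w y
    span′ = affine-span-transfer same span
    open TradeOnPivotBasis {𝒯 = 𝒯} {w} {y} span′ piv {T₀} {T₁} trade union using (pairwise-disjoint)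

  sufficiency : (Σ (Subset v) λ w → Σ (Fin (suc t) → Subset v) λ x →
                   LinIndep x × PairwiseDisjoint x × IsAffineSpan 𝒯 w x) →
                Σ (Family v) λ T₀ → Σ (Family v) λ T₁ → IsTrade t T₀ T₁ × UnionIs T₀ T₁ 𝒯
  sufficiency (_ , _ , indep′ , disjoint , span″) = T₀ , T₁ , trade , union
    where open DisjointBasis indep′ disjoint span″
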